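{- Let $n\ge 2$, let $\sigma$ be a prefix normal word chain generator of length $n$ (a permutation of $[n]$), and let $j\in[n-1]$. Let $\sigma'$ be the permutation obtained from $\sigma$ by swapping the entries at positions $j$ and $j+1$, i.e. $\sigma'[j]=\sigma[j+1]$, $\sigma'[j+1]=\sigma[j]$, and $\sigma'[k]=\sigma[k]$ for $k\notin\{j,j+1\}$. If $\sigma[j] < \sigma[j+1]$, then $\sigma'$ is also a prefix normal word chain generator.
   Context: Words are over $\{0,1\}$. For a word $w$, $|w|_1$ is the number of $1$s in $w$ and $\mathrm{pref}_k(w)$ its prefix of length $k$; a factor is a contiguous subword. A word $w$ is prefix normal if every factor $v$ of $w$ satisfies $|v|_1 \le |\mathrm{pref}_{|v|}(w)|_1$. A permutation $\sigma$ of $[n]$ is written in one-line notation with $\sigma[i]=\sigma(i)$. Its word chain $c_\sigma=(c_\sigma[1],\dots,c_\sigma[n+1])$ consists of words of length $n$ with $c_\sigma[1]=1^n$ and $c_\sigma[i+1]$ obtained from $c_\sigma[i]$ by changing the letter at position $\sigma(i)$ from $1$ to $0$ ($i\in[n]$). The permutation $\sigma$ is a prefix normal word chain generator if all words $c_\sigma[i]$ are prefix normal. -}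

module Defs where

open import Data.Nat using (ℕ; zero; suc; _+_; _≤_; _<_)
open import Data.Bool using (Bool; true; false)
open import Data.Fin using (Fin; toℕ)
open import Data.List using (List; []; _∷_; length; take; drop; tabulate)
open import Data.Fin.Permutation using (Permutation′; _⟨$⟩ʳ_)
open import Relation.Binary.PropositionalEquality using (_≡_)
open import Relation.Nullary using (Dec; yes; no; ¬_)
open import Data.Bool using (T)
open import Relation.Nullary.Decidable using (does)
open import Data.Nat using (_<?_)
open import Data.Fin using (_≟_)
open import Data.List.Relation.Unary.Any using (Any; any?)
open import Data.List using (allFin; filter)

-- Words over {0,1}: lists of Booleans, true = 1, false = 0.
Word : Set
Word = List Bool

ones : Word → ℕ
ones [] = 0
ones (true ∷ w) = suc (ones w)
ones (false ∷ w) = ones w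

factor : ℕ → ℕ → Word → Word
factor s ℓ w = take ℓ (drop s w)

PrefixNormal : Word → Set
PrefixNormal w = ∀ (s ℓ : ℕ) → s + ℓ ≤ length w →
  ones (factor s ℓ w) ≤ ones (take ℓ w)

-- Word chain (0-indexed): chainWord σ i (i = 0..n) is c_σ[i+1]:
-- the word 1^n with the letters at positions σ(0),…,σ(i-1) set to 0.
-- (Positions and permutation entries are 0-indexed: Fin n.)
zeroed : ∀ {n} → Permutation′ n → ℕ → Fin n → Bool
zeroed {n} σ i p = does (any? (λ k → σ ⟨$⟩ʳ k ≟ p) (filter (λ k → toℕ k <? i) (allFin n)))

flipB : Bool → Bool
flipB true = false
flipB false = true

chainWord : ∀ {n} → Permutation′ n → ℕ → Word
chainWord {n} σ i = tabulate (λ p → flipB (zeroed σ i p))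

PNGenerator : ∀ {n} → Permutation′ n → Set
PNGenerator {n} σ = ∀ (i : ℕ) → i ≤ n → PrefixNormal (chainWord σ i)

{-# OPTIONS --safe #-}
module Submission where

-- Let a = σ(j) < b = σ(j+1), and let u, w, v be the words of the chain of σ′
-- after j, j+1 and j+2 steps.  Only w is new: u and v also occur in the chain
-- of σ, and w is u with the 1 at b turned off, or v with the 0 at a turned on.
-- A factor of w of length at most b has at most as many 1s as the same factor
-- of u, hence as the prefix of u, which is also the prefix of w.  A longer
-- factor has at most one 1 more than the same factor of v, hence than the
-- prefix of v, and the prefix of w has exactly one 1 more since it covers a.

open import Defs
open import Data.Nat using (ℕ; zero; suc; _+_; _≤_; _<_; z≤n; s≤s; _<?_)
open import Data.Nat.Properties
  using (≤-refl; <-irrefl; <-trans; <⇒≤; ≤-pred; n≤1+n; m≤n⇒m≤1+n; ≤∧≢⇒<; ≰⇒>; _≤?_; 1+n≢n; module ≤-Reasoning)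
  renaming (_≟_ to _≟ℕ_)
open import Data.Bool using (Bool; true; false)
open import Data.Fin using (Fin; toℕ; _≟_)
import Data.Fin as Fin
open import Data.Fin.Properties using (toℕ-injective; toℕ<n; suc-injective)
open import Data.Fin.Permutation using (Permutation′; _⟨$⟩ʳ_)
open import Data.List using (_∷_; length; take; tabulate; filter; allFin)
open import Data.List.Properties using (tabulate-cong)
open import Data.List.Relation.Unary.Any using (Any; any?)
open import Data.List.Membership.Propositional using (find; lose)
open import Data.List.Membership.Propositional.Properties using (∈-filter⁺; ∈-filter⁻; ∈-allFin)
open import Data.Product using (_,_; proj₂)
open import Function using (_∘_; _∘′_)
open import Function.Bundles using (_⇔_; mk⇔; Injection)
open import Function.Properties.Inverse using (↔⇒↣)
import Function.Properties.Equivalence as ⇔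
open import Relation.Binary.PropositionalEquality
open import Relation.Nullary using (Dec; yes; no; ¬_)
open import Relation.Nullary.Decidable using (map; dec-true; dec-false; does-⇔)

data Raised : ℕ → Word → Word → Set where
  here  : ∀ {w} → Raised 0 (false ∷ w) (true ∷ w)
  there : ∀ {p b x y} → Raised p x y → Raised (suc p) (b ∷ x) (b ∷ y)

private variable
  p : ℕ
  x y : Word

Raised-length : Raised p x y → length x ≡ length y
Raised-length here      = refl
Raised-length (there r) = cong suc (Raised-length r)

ones-factor-raised-≤ : ∀ s ℓ → Raised p x y → ones (factor s ℓ x) ≤ ones (factor s ℓ y)
ones-factor-raised-≤ zero    zero    _                   = z≤n
ones-factor-raised-≤ zero    (suc ℓ) here                = n≤1+n _
ones-factor-raised-≤ zero    (suc ℓ) (there {b = false} r) = ones-factor-raised-≤ 0 ℓ r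
ones-factor-raised-≤ zero    (suc ℓ) (there {b = true} r)  = s≤s (ones-factor-raised-≤ 0 ℓ r)
ones-factor-raised-≤ (suc s) ℓ       here                = ≤-refl
ones-factor-raised-≤ (suc s) ℓ       (there r)           = ones-factor-raised-≤ s ℓ r

ones-factor-raised-≤suc : ∀ s ℓ → Raised p x y → ones (factor s ℓ y) ≤ suc (ones (factor s ℓ x))
ones-factor-raised-≤suc zero    zero    _                   = z≤n
ones-factor-raised-≤suc zero    (suc ℓ) here                = ≤-refl
ones-factor-raised-≤suc zero    (suc ℓ) (there {b = false} r) = ones-factor-raised-≤suc 0 ℓ r
ones-factor-raised-≤suc zero    (suc ℓ) (there {b = true} r)  = s≤s (ones-factor-raised-≤suc 0 ℓ r)
ones-factor-raised-≤suc (suc s) ℓ       here                = n≤1+n _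
ones-factor-raised-≤suc (suc s) ℓ       (there r)           = ones-factor-raised-≤suc s ℓ r

take-raised : ∀ ℓ → Raised p x y → ℓ ≤ p → take ℓ x ≡ take ℓ y
take-raised zero    _                 _         = refl
take-raised (suc ℓ) (there {b = b} r) (s≤s ℓ≤p) = cong (b ∷_) (take-raised ℓ r ℓ≤p)

ones-take-raised : ∀ ℓ → Raised p x y → p < ℓ → ones (take ℓ y) ≡ suc (ones (take ℓ x))
ones-take-raised (suc ℓ) here                  _         = refl
ones-take-raised (suc ℓ) (there {b = false} r) (s≤s p<ℓ) = ones-take-raised ℓ r p<ℓ
ones-take-raised (suc ℓ) (there {b = true} r)  (s≤s p<ℓ) = cong suc (ones-take-raised ℓ r p<ℓ)

prefixNormal-between : ∀ {a b u v w} → Raised b w u → Raised a v w → a < b →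
  PrefixNormal u → PrefixNormal v → PrefixNormal w
prefixNormal-between {a} {b} {u} {v} {w} w↑u v↑w a<b pn-u pn-v s ℓ s+ℓ≤|w| with ℓ ≤? b
... | yes ℓ≤b = begin
  ones (factor s ℓ w) ≤⟨ ones-factor-raised-≤ s ℓ w↑u ⟩
  ones (factor s ℓ u) ≤⟨ pn-u s ℓ (subst (s + ℓ ≤_) (Raised-length w↑u) s+ℓ≤|w|) ⟩
  ones (take ℓ u)     ≡⟨ cong ones (take-raised ℓ w↑u ℓ≤b) ⟨
  ones (take ℓ w)     ∎
  where open ≤-Reasoning
... | no ℓ≰b = begin
  ones (factor s ℓ w)       ≤⟨ ones-factor-raised-≤suc s ℓ v↑w ⟩
  suc (ones (factor s ℓ v)) ≤⟨ s≤s (pn-v s ℓ (subst (s + ℓ ≤_) (sym (Raised-length v↑w)) s+ℓ≤|w|)) ⟩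
  suc (ones (take ℓ v))     ≡⟨ ones-take-raised ℓ v↑w (<-trans a<b (≰⇒> ℓ≰b)) ⟨
  ones (take ℓ w)           ∎
  where open ≤-Reasoning

tabulate-raised : ∀ {n} {f g : Fin n → Bool} (q : Fin n) → f q ≡ false → g q ≡ true →
  (∀ p → p ≢ q → f p ≡ g p) → Raised (toℕ q) (tabulate f) (tabulate g)
tabulate-raised {f = f} {g} Fin.zero fq gq f≗g
  rewrite fq | gq | tabulate-cong {f = f ∘′ Fin.suc} {g = g ∘′ Fin.suc} (λ p → f≗g (Fin.suc p) λ ())
  = here
tabulate-raised {f = f} {g} (Fin.suc q) fq gq f≗g
  rewrite f≗g Fin.zero (λ ())
  = there (tabulate-raised q fq gq λ p p≢q → f≗g (Fin.suc p) (p≢q ∘ suc-injective))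

data Zeroed {n} (σ : Permutation′ n) (i : ℕ) : Fin n → Set where
  zeroedAt : ∀ k → toℕ k < i → Zeroed σ i (σ ⟨$⟩ʳ k)

module _ {n} {σ : Permutation′ n} {i : ℕ} {p : Fin n} where

  private
    before? : (k : Fin n) → Dec (toℕ k < i)
    before? k = toℕ k <? i

  Zeroed⇔Any : Zeroed σ i p ⇔ Any (λ k → σ ⟨$⟩ʳ k ≡ p) (filter before? (allFin n))
  Zeroed⇔Any = mk⇔
    (λ { (zeroedAt k k<i) → lose (∈-filter⁺ before? (∈-allFin k) k<i) refl })
    (λ σk≡p∈ → let k , k∈ , σk≡p = find σk≡p∈
               in subst (Zeroed σ i) σk≡p (zeroedAt k (proj₂ (∈-filter⁻ before? {xs = allFin n} k∈))))

  zeroed? : Dec (Zeroed σ i p)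
  zeroed? = map (⇔.sym Zeroed⇔Any) (any? (λ k → σ ⟨$⟩ʳ k ≟ p) (filter before? (allFin n)))

  zeroed-true : Zeroed σ i p → zeroed σ i p ≡ true
  zeroed-true = dec-true zeroed?

  zeroed-false : ¬ Zeroed σ i p → zeroed σ i p ≡ false
  zeroed-false = dec-false zeroed?

zeroed-cong : ∀ {n} {σ τ : Permutation′ n} {i i′ p} → Zeroed σ i p ⇔ Zeroed τ i′ p →
  zeroed σ i p ≡ zeroed τ i′ p
zeroed-cong z⇔z′ = does-⇔ z⇔z′ zeroed? zeroed?

chainWord-cong : ∀ {n} {σ τ : Permutation′ n} {i i′} → (∀ p → Zeroed σ i p ⇔ Zeroed τ i′ p) →
  chainWord σ i ≡ chainWord τ i′
chainWord-cong z⇔z′ = tabulate-cong (λ p → cong flipB (zeroed-cong (z⇔z′ p)))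

module _ {n} (σ : Permutation′ n) (k : Fin n) where

  Zeroed-before : ∀ {p} → Zeroed σ (toℕ k) p → p ≢ σ ⟨$⟩ʳ k
  Zeroed-before (zeroedAt k′ k′<k) σk′≡σk =
    <-irrefl (cong toℕ (Injection.injective (↔⇒↣ σ) σk′≡σk)) k′<k

  Zeroed-suc : ∀ {p} → p ≢ σ ⟨$⟩ʳ k → Zeroed σ (suc (toℕ k)) p ⇔ Zeroed σ (toℕ k) p
  Zeroed-suc p≢σk = mk⇔
    (λ { (zeroedAt k′ k′≤k) → zeroedAt k′ (≤∧≢⇒< (≤-pred k′≤k) (p≢σk ∘ cong (σ ⟨$⟩ʳ_) ∘ toℕ-injective)) })
    (λ { (zeroedAt k′ k′<k) → zeroedAt k′ (m≤n⇒m≤1+n k′<k) })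

  chainWord-step : Raised (toℕ (σ ⟨$⟩ʳ k)) (chainWord σ (suc (toℕ k))) (chainWord σ (toℕ k))
  chainWord-step = tabulate-raised (σ ⟨$⟩ʳ k)
    (cong flipB (zeroed-true (zeroedAt {σ = σ} k ≤-refl)))
    (cong flipB (zeroed-false λ z → Zeroed-before z refl))
    (λ p p≢σk → cong flipB (zeroed-cong (Zeroed-suc p≢σk)))

record Transposed {n} (j j₁ : Fin n) (σ σ′ : Permutation′ n) : Set where
  field
    at-j      : σ′ ⟨$⟩ʳ j ≡ σ ⟨$⟩ʳ j₁
    at-j₁     : σ′ ⟨$⟩ʳ j₁ ≡ σ ⟨$⟩ʳ j
    elsewhere : ∀ k → k ≢ j → k ≢ j₁ → σ′ ⟨$⟩ʳ k ≡ σ ⟨$⟩ʳ k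

Transposed-sym : ∀ {n} {j j₁ : Fin n} {σ σ′} → Transposed j j₁ σ σ′ → Transposed j j₁ σ′ σ
Transposed-sym t = record
  { at-j = sym at-j₁ ; at-j₁ = sym at-j ; elsewhere = λ k k≢j k≢j₁ → sym (elsewhere k k≢j k≢j₁) }
  where open Transposed t

module _ {n} {j j₁ : Fin n} {σ σ′ : Permutation′ n} (t : Transposed j j₁ σ σ′)
         (adjacent : toℕ j₁ ≡ suc (toℕ j)) where
  open Transposed t

  Zeroed-transposed : ∀ {i p} → i ≢ toℕ j₁ → Zeroed σ′ i p → Zeroed σ i p
  Zeroed-transposed {i} i≢j₁ (zeroedAt k k<i) with k ≟ j | k ≟ j₁
  ... | yes refl | _ =
    subst (Zeroed σ i) (sym at-j) (zeroedAt j₁ (≤∧≢⇒< (subst (_≤ i) (sym adjacent) k<i) (i≢j₁ ∘ sym)))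
  ... | no _ | yes refl =
    subst (Zeroed σ i) (sym at-j₁) (zeroedAt j (<-trans (subst (toℕ j <_) (sym adjacent) ≤-refl) k<i))
  ... | no k≢j | no k≢j₁ = subst (Zeroed σ i) (sym (elsewhere k k≢j k≢j₁)) (zeroedAt k k<i)

module _ {n} {j j₁ : Fin n} {σ σ′ : Permutation′ n} (t : Transposed j j₁ σ σ′)
         (adjacent : toℕ j₁ ≡ suc (toℕ j)) where

  chainWord-transposed : ∀ {i} → i ≢ toℕ j₁ → chainWord σ′ i ≡ chainWord σ i
  chainWord-transposed i≢j₁ = chainWord-cong λ p →
    mk⇔ (Zeroed-transposed t adjacent i≢j₁) (Zeroed-transposed (Transposed-sym t) adjacent i≢j₁)

  open Transposed t

  prefixNormal-transposed : toℕ (σ ⟨$⟩ʳ j) < toℕ (σ ⟨$⟩ʳ j₁) →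
    PrefixNormal (chainWord σ (toℕ j)) → PrefixNormal (chainWord σ (suc (toℕ j₁))) →
    PrefixNormal (chainWord σ′ (toℕ j₁))
  prefixNormal-transposed = prefixNormal-between raised-at-σj₁ raised-at-σj
    where
    j≢j₁ : toℕ j ≢ toℕ j₁
    j≢j₁ j≡j₁ = 1+n≢n (sym (trans j≡j₁ adjacent))
    raised-at-σj₁ : Raised (toℕ (σ ⟨$⟩ʳ j₁)) (chainWord σ′ (toℕ j₁)) (chainWord σ (toℕ j))
    raised-at-σj₁
      rewrite sym at-j | sym (chainWord-transposed j≢j₁) | adjacent
      = chainWord-step σ′ j
    raised-at-σj : Raised (toℕ (σ ⟨$⟩ʳ j)) (chainWord σ (suc (toℕ j₁))) (chainWord σ′ (toℕ j₁))
    raised-at-σj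
      rewrite sym at-j₁ | sym (chainWord-transposed 1+n≢n)
      = chainWord-step σ′ j₁

  PNGenerator-transposed : PNGenerator σ → toℕ (σ ⟨$⟩ʳ j) < toℕ (σ ⟨$⟩ʳ j₁) → PNGenerator σ′
  PNGenerator-transposed pn σj<σj₁ i i≤n with i ≟ℕ toℕ j₁
  ... | yes refl = prefixNormal-transposed σj<σj₁ (pn (toℕ j) (<⇒≤ (toℕ<n j))) (pn (suc (toℕ j₁)) (toℕ<n j₁))
  ... | no i≢j₁ = subst PrefixNormal (sym (chainWord-transposed i≢j₁)) (pn i i≤n)

mainTheorem3 : (n : ℕ) → 2 ≤ n → (σ σ′ : Permutation′ n) → PNGenerator σ →
    (j j₁ : Fin n) → toℕ j₁ ≡ suc (toℕ j) →
    σ′ ⟨$⟩ʳ j ≡ σ ⟨$⟩ʳ j₁ → σ′ ⟨$⟩ʳ j₁ ≡ σ ⟨$⟩ʳ j →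
    (∀ (k : Fin n) → k ≢ j → k ≢ j₁ → σ′ ⟨$⟩ʳ k ≡ σ ⟨$⟩ʳ k) →
    toℕ (σ ⟨$⟩ʳ j) < toℕ (σ ⟨$⟩ʳ j₁) →
    PNGenerator σ′
mainTheorem3 _ _ σ σ′ pn j j₁ adjacent at-j at-j₁ elsewhere =
  PNGenerator-transposed transposed adjacent pn
  where
  transposed : Transposed j j₁ σ σ′
  transposed = record { at-j = at-j ; at-j₁ = at-j₁ ; elsewhere = elsewhere }
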